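{- Let $n\ge 3$ and let $R$ be a $p_2$-orientation of $P_n$. Then: (i) the multiplier of $v_1$ is $1$; (ii) if $e_2$ is flat, the multiplier of $v_2$ is $1$; if $e_2$ is directed, the multiplier of $v_2$ is $2$; (iii) if $e_{n-2}$ is flat, the multiplier of $v_n$ is $1$; if $e_{n-2}$ is directed, the multiplier of $v_n$ is $2$. Here each statement about a multiplier means: for every admissible choice of $a_1,\dots,a_{k-1}$ (as in the context), the number of admissible values $b$ for $v_k$ equals the stated value.
   Context: Parallel Diffusion on a finite simple graph $G$: a configuration assigns an integer stack size $|v|$ (possibly negative) to each vertex. In one step all vertices fire simultaneously: each vertex sends one chip to each neighbour with strictly smaller stack size. Starting from $C_0$, $C_{t+1}$ is obtained from $C_t$ by one step. A configuration $D$ is a $p_2$-configuration if there are $C_0$ and $N$ such that $C_{t+2}=C_t$ and $C_{t+1}\ne C_t$ for all $t\ge N$, and $D=C_t$ for some $t\ge N$. The path $P_n$ has vertices $v_1,\dots,v_n$ and edges $e_i=v_iv_{i+1}$. A configuration induces the orientation in which each edge is directed from its endpoint with larger stack size to its endpoint with smaller stack size, and is flat if equal; a $p_2$-orientation is one induced by a $p_2$-configuration. Convention: only configurations with $|v_1|=0$ are considered. Multiplier: for a $p_2$-orientation $R$ of $P_n$, an index $1\le k\le n$, and integers $a_1,\dots,a_{k-1}$ that are admissible (there is a $p_2$-configuration $C$ inducing $R$ with $|v_1|^C=0$ and $|v_i|^C=a_i$ for all $i<k$), the multiplier of $v_k$ is the number of integers $b$ for which there is a $p_2$-configuration $C$ inducing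 $R$ with $|v_1|^C=0$, $|v_i|^C=a_i$ for $i<k$, and $|v_k|^C=b$. -}

module Defs where

open import Data.Nat as ℕ using (ℕ; zero; suc)
open import Data.Integer as ℤ using (ℤ; +_; _+_; _-_; 0ℤ; 1ℤ)
open import Data.Integer.Properties using (_<?_)
open import Data.Fin using (Fin; zero; suc; toℕ; inject₁)
open import Data.Fin.Properties using (_≟_)
open import Data.Vec using (Vec; tabulate)
open import Data.List using (List; foldr; map; length)
open import Data.List.Relation.Unary.Unique.Propositional using (Unique)
open import Data.List.Membership.Propositional using (_∈_)
open import Data.Bool using (Bool; true; false; if_then_else_; _∨_)
open import Data.Product using (Σ; _×_; ∃)
open import Data.Fin.Base using () renaming (toℕ to fin→ℕ)
open import Function.Bundles using (_⇔_)
open import Relation.Nullary using (¬_; does)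
open import Relation.Binary.PropositionalEquality using (_≡_)
open import Data.List using () renaming ([] to nil)
open import Data.List.Base using (allFin)

Graph : ℕ → Set
Graph n = Fin n → Fin n → Bool

-- The path P_n : vertices v_1,…,v_n are the elements 0,…,n-1 of Fin n,
-- v_i adjacent to v_{i+1}.
pathGraph : (n : ℕ) → Graph n
pathGraph n u v = (suc (toℕ u) ℕ.≡ᵇ toℕ v) ∨ (suc (toℕ v) ℕ.≡ᵇ toℕ u)

Config : ℕ → Set
Config n = Fin n → ℤ

_≋_ : ∀ {n} → Config n → Config n → Set
C ≋ D = ∀ v → C v ≡ D v

sumℤ : List ℤ → ℤ
sumℤ = foldr _+_ 0ℤ

-- net chips received by v from neighbour u in one step:
-- +1 if u has strictly larger stack (u fires a chip to v),
-- -1 if u has strictly smaller stack (v fires a chip to u), 0 otherwise.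
flow : ℤ → ℤ → ℤ
flow cu cv = if does (cv <? cu) then 1ℤ else (if does (cu <? cv) then ℤ.- 1ℤ else 0ℤ)

step : ∀ {n} → Graph n → Config n → Config n
step {n} G C v =
  C v + sumℤ (map (λ u → if G u v then flow (C u) (C v) else 0ℤ) (allFin n))

iter : ∀ {n} → Graph n → ℕ → Config n → Config n
iter G zero    C = C
iter G (suc t) C = step G (iter G t C)

IsP2Config : ∀ {n} → Graph n → Config n → Set
IsP2Config {n} G D =
  Σ (Config n) λ C₀ → Σ ℕ λ N →
    (∀ t → N ℕ.≤ t →
        (iter G (suc (suc t)) C₀ ≋ iter G t C₀)
      × ¬ (iter G (suc t) C₀ ≋ iter G t C₀))
  × Σ ℕ (λ t → N ℕ.≤ t × D ≋ iter G t C₀)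

-- Orientations of the path P_{suc n}: edge e_{i+1} = v_{i+1} v_{i+2} for i : Fin n.

data Dir : Set where
  forward  : Dir   -- e_i directed v_i → v_{i+1}   (|v_i| > |v_{i+1}|)
  backward : Dir   -- e_i directed v_{i+1} → v_i   (|v_i| < |v_{i+1}|)
  flat     : Dir   -- |v_i| = |v_{i+1}|

cmpDir : ℤ → ℤ → Dir
cmpDir x y = if does (y <? x) then forward else (if does (x <? y) then backward else flat)

-- orientation induced by a configuration of P_{suc n}; entry i is edge e_{i+1}
orient : ∀ {n} → Config (suc n) → Vec Dir n
orient C = tabulate (λ i → cmpDir (C (inject₁ i)) (C (suc i)))

-- p_2-configuration of the path P_{suc n} with the convention |v_1| = 0
IsP2Path : ∀ {n} → Config (suc n) → Set
IsP2Path {n} C = IsP2Config (pathGraph (suc n)) C × C zero ≡ 0ℤ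

IsP2Orientation : ∀ {n} → Vec Dir n → Set
IsP2Orientation {n} R = Σ (Config (suc n)) λ C → IsP2Path C × orient C ≡ R

AgreesBefore : ∀ {n} → Fin n → Config n → (Fin n → ℤ) → Set
AgreesBefore v C a = ∀ i → toℕ i ℕ.< toℕ v → C i ≡ a i

Admissible : ∀ {n} → Vec Dir n → Fin (suc n) → (Fin (suc n) → ℤ) → Set
Admissible {n} R v a =
  Σ (Config (suc n)) λ C → IsP2Path C × orient C ≡ R × AgreesBefore v C a

Candidate : ∀ {n} → Vec Dir n → Fin (suc n) → (Fin (suc n) → ℤ) → ℤ → Set
Candidate {n} R v a b =
  Σ (Config (suc n)) λ C →
    IsP2Path C × orient C ≡ R × AgreesBefore v C a × C v ≡ b

HasExactly : ℕ → (ℤ → Set) → Set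
HasExactly m P =
  Σ (List ℤ) λ xs → length xs ≡ m × Unique xs × (∀ b → P b ⇔ (b ∈ xs))

MultiplierIs : ∀ {n} → Vec Dir n → Fin (suc n) → (Fin (suc n) → ℤ) → ℕ → Set
MultiplierIs R v a m = HasExactly m (Candidate R v a)

module Submission where

-- One step moves a chip across every non-flat edge, so the dynamics sees a configuration only
-- through the flows along its edges: it commutes with translations, and a configuration whose flows
-- agree with those of a 2-periodic one, both now and after one step, is itself 2-periodic.
-- At an end of the path, with leaf ℓ, neighbour p and next vertex q, 2-periodicity at ℓ is a
-- condition on the offset d = |ℓ| - |p| and the flow t from q into p alone. If t = 0 it forces
-- d ∈ {-1, 0, 1}, so d is the sign fixed by the orientation of pℓ; if t = ±1 it forces d ∈ {t, 2t},
-- and moving the leaf between these two offsets leaves all flows unchanged, before and after a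
-- step, so both values occur.
-- The vertex v₂ is the neighbour of the leaf v₁ (where |v₁| = 0), and vₙ is itself a leaf.

open import Defs
open import Data.Nat as ℕ using (ℕ; zero; suc; s≤s; z≤n)
open import Data.Nat.Properties using (≤-reflexive; <-irrefl)
open import Data.Integer using (ℤ; +_; -[1+_]; _+_; _-_; -_; 0ℤ; 1ℤ; _<_)
open import Data.Integer.Properties
  using (_<?_; +-monoˡ-<; <-asym; +-comm; +-assoc; +-identityˡ; +-identityʳ; +-inverseʳ;
         neg-involutive; neg-distrib-+; +-0-abelianGroup)
open import Algebra.Properties.AbelianGroup +-0-abelianGroup
  using (inverseʳ-unique) renaming (∙-cancelˡ to +-cancelˡ; xyx⁻¹≈y to x+y-x≡y)
open import Data.Integer.Tactic.RingSolver using (solve-∀)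
open import Data.Fin using (Fin; zero; suc; toℕ; fromℕ; inject₁)
open import Data.Fin.Properties using (_≟_; suc-injective; toℕ-inject₁)
open import Data.Bool using (true; false; if_then_else_)
open import Data.Bool.Properties using (∨-comm)
open import Data.List using ([]; _∷_; map; tabulate; allFin)
open import Data.List.Properties using (map-tabulate; map-cong)
open import Data.List.Relation.Unary.All using ([]; _∷_)
open import Data.List.Relation.Unary.AllPairs using ([]; _∷_)
open import Data.List.Relation.Unary.Any using (here; there)
open import Data.List.Membership.Propositional using (_∈_)
open import Data.Vec using (Vec; lookup)
open import Data.Vec.Properties using (lookup∘tabulate; tabulate-cong)
open import Data.Vec.Functional using (updateAt)
open import Data.Vec.Functional.Properties using (updateAt-updates; updateAt-minimal)
open import Data.Product using (_×_; _,_; proj₁; proj₂)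
open import Data.Sum using (_⊎_; inj₁; inj₂)
import Data.Sum as Sum
open import Data.Empty using (⊥-elim)
open import Function.Base using (id; _∘_)
open import Function.Bundles using (_⇔_; mk⇔)
open import Relation.Nullary using (¬_; yes; no; does)
open import Relation.Nullary.Decidable using (does-⇔)
open import Relation.Binary.PropositionalEquality

x+y-y≡x : ∀ x y → x + y - y ≡ x
x+y-y≡x = solve-∀

x+[y-x]≡y : ∀ x y → x + (y - x) ≡ y
x+[y-x]≡y = solve-∀

x-y≡z⇒x≡y+z : ∀ x y z → x - y ≡ z → x ≡ y + z
x-y≡z⇒x≡y+z x y z e = trans (sym (x+[y-x]≡y y x)) (cong (_+_ y) e)

0-x≡y⇒x≡-y : ∀ x y → 0ℤ - x ≡ y → x ≡ - y
0-x≡y⇒x≡-y x y e = trans (sym (neg-involutive x)) (cong -_ (trans (sym (+-identityˡ (- x))) e))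

x+y+z≡x⇒z≡-y : ∀ x y z → x + y + z ≡ x → z ≡ - y
x+y+z≡x⇒z≡-y x y z e =
  inverseʳ-unique y z (+-cancelˡ x (y + z) 0ℤ (trans (sym (+-assoc x y z)) (trans e (sym (+-identityʳ x)))))

+-<-cancelʳ⇔ : ∀ a b c → (a + c < b + c) ⇔ (a < b)
+-<-cancelʳ⇔ a b c =
  mk⇔ (λ h → subst₂ _<_ (x+y-y≡x a c) (x+y-y≡x b c) (+-monoˡ-< (- c) h)) (+-monoˡ-< c)

flow-+ʳ : ∀ a b c → flow (a + c) (b + c) ≡ flow a b
flow-+ʳ a b c
  rewrite does-⇔ (+-<-cancelʳ⇔ b a c) (b + c <? a + c) (b <? a)
        | does-⇔ (+-<-cancelʳ⇔ a b c) (a + c <? b + c) (a <? b) = refl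

flow-anti : ∀ a b → flow b a ≡ - flow a b
flow-anti a b with b <? a | a <? b
... | yes b<a | yes a<b = ⊥-elim (<-asym b<a a<b)
... | yes _   | no _    = refl
... | no _    | yes _   = refl
... | no _    | no _    = refl

flow-offsetˡ : ∀ a b → flow b a ≡ flow (b - a) 0ℤ
flow-offsetˡ a b = trans (cong₂ flow (recentre b a) (sym (+-identityˡ a))) (flow-+ʳ (b - a) 0ℤ a)
  where
  recentre : ∀ b a → b ≡ b - a + a
  recentre = solve-∀

flow-offsetʳ : ∀ a b → flow a b ≡ flow 0ℤ (b - a)
flow-offsetʳ a b = trans (flow-anti b a) (trans (cong -_ (flow-offsetˡ a b)) (sym (flow-anti (b - a) 0ℤ)))

dirFlow : Dir → ℤ
dirFlow forward  = 1ℤ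
dirFlow backward = - 1ℤ
dirFlow flat     = 0ℤ

flow≡dirFlow : ∀ a b → flow a b ≡ dirFlow (cmpDir a b)
flow≡dirFlow a b with does (b <? a)
... | true  = refl
... | false with does (a <? b)
...   | true  = refl
...   | false = refl

dirFlow-injective : ∀ {d e} → dirFlow d ≡ dirFlow e → d ≡ e
dirFlow-injective {forward}  {forward}  _ = refl
dirFlow-injective {backward} {backward} _ = refl
dirFlow-injective {flat}     {flat}     _ = refl
dirFlow-injective {forward}  {backward} ()
dirFlow-injective {forward}  {flat}     ()
dirFlow-injective {backward} {forward}  ()
dirFlow-injective {backward} {flat}     ()
dirFlow-injective {flat}     {forward}  ()
dirFlow-injective {flat}     {backward} ()

-- Parallel Diffusion on a graph

Period2 : ∀ {n} → Graph n → Config n → Set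
Period2 G D = step G (step G D) ≋ D × ¬ (step G D ≋ D)

inflow : ∀ {n} → Graph n → Config n → Fin n → ℤ
inflow {n} G C v = sumℤ (map (λ u → if G u v then flow (C u) (C v) else 0ℤ) (allFin n))

SameFlow : ∀ {n} → Graph n → Config n → Config n → Set
SameFlow G C C' = ∀ u v → G u v ≡ true → flow (C u) (C v) ≡ flow (C' u) (C' v)

module _ {n} (G : Graph n) where

  inflow-cong : ∀ C C' → SameFlow G C C' → ∀ v → inflow G C v ≡ inflow G C' v
  inflow-cong C C' sf v = cong sumℤ (map-cong edge (allFin n))
    where
    edge : ∀ u → (if G u v then flow (C u) (C v) else 0ℤ) ≡ (if G u v then flow (C' u) (C' v) else 0ℤ)
    edge u with G u v in uv
    ... | true  = sf u v uv
    ... | false = refl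

  step-cong : ∀ {C C'} → C ≋ C' → step G C ≋ step G C'
  step-cong {C} {C'} C≋C' v =
    cong₂ _+_ (C≋C' v) (inflow-cong C C' (λ u w _ → cong₂ flow (C≋C' u) (C≋C' w)) v)

  step-agree : ∀ {C C'} {ℓ} → SameFlow G C C' → (∀ u → u ≢ ℓ → C u ≡ C' u) →
               ∀ u → u ≢ ℓ → step G C u ≡ step G C' u
  step-agree {C} {C'} sf agree u u≢ℓ = cong₂ _+_ (agree u u≢ℓ) (inflow-cong C C' sf u)

  iter-period2 : ∀ {D} → step G (step G D) ≋ D → ∀ t → iter G (suc (suc t)) D ≋ iter G t D
  iter-period2 e zero    = e
  iter-period2 e (suc t) = step-cong (iter-period2 e t)

  iter-nonfixed : ∀ {D} → Period2 G D → ∀ t → ¬ (iter G (suc t) D ≋ iter G t D)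
  iter-nonfixed (_ , ne) zero = ne
  iter-nonfixed p@(e , _) (suc t) fixed = iter-nonfixed p t λ v →
    trans (sym (iter-period2 e (suc t) v)) (trans (step-cong fixed v) (iter-period2 e t v))

  Period2⇒IsP2Config : ∀ {D} → Period2 G D → IsP2Config G D
  Period2⇒IsP2Config {D} p =
    D , 0 , (λ t _ → iter-period2 (proj₁ p) t , iter-nonfixed p t) , 0 , z≤n , λ _ → refl

  IsP2Config⇒Period2 : ∀ {D} → IsP2Config G D → Period2 G D
  IsP2Config⇒Period2 {D} (C₀ , N , periodic , t , N≤t , D≋Cₜ) = period , nonfixed
    where
    Cₜ = iter G t C₀
    Cₜ≋D : Cₜ ≋ D
    Cₜ≋D v = sym (D≋Cₜ v)
    period : step G (step G D) ≋ D
    period v = trans (step-cong (step-cong D≋Cₜ) v) (trans (proj₁ (periodic t N≤t) v) (Cₜ≋D v))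
    nonfixed : ¬ (step G D ≋ D)
    nonfixed fixed = proj₂ (periodic t N≤t) λ v → trans (step-cong Cₜ≋D v) (trans (fixed v) (D≋Cₜ v))

  period2-inflow : ∀ {D} → step G (step G D) ≋ D → ∀ v → inflow G (step G D) v ≡ - inflow G D v
  period2-inflow {D} e v = x+y+z≡x⇒z≡-y (D v) (inflow G D v) (inflow G (step G D) v) (e v)

  period2-transfer : ∀ {C C'} → SameFlow G C C' → SameFlow G (step G C) (step G C') →
                     Period2 G C → Period2 G C'
  period2-transfer {C} {C'} sf sf' (e , ne) = period , nonfixed
    where
    open ≡-Reasoning
    period : step G (step G C') ≋ C'
    period v = begin
      C' v + inflow G C' v + inflow G (step G C') v
        ≡⟨ cong₂ (λ x y → C' v + x + y) (inflow-cong C C' sf v) (inflow-cong (step G C) (step G C') sf' v) ⟨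
      C' v + inflow G C v + inflow G (step G C) v
        ≡⟨ cong (_+_ (C' v + inflow G C v)) (period2-inflow e v) ⟩
      C' v + inflow G C v - inflow G C v
        ≡⟨ x+y-y≡x (C' v) (inflow G C v) ⟩
      C' v ∎
    nonfixed : ¬ (step G C' ≋ C')
    nonfixed fixed = ne λ v → begin
      C v + inflow G C v  ≡⟨ cong (_+_ (C v)) (inflow-cong C C' sf v) ⟩
      C v + inflow G C' v ≡⟨ cong (_+_ (C v)) (+-cancelˡ (C' v) _ 0ℤ (trans (fixed v) (sym (+-identityʳ _)))) ⟩
      C v + 0ℤ            ≡⟨ +-identityʳ (C v) ⟩
      C v                 ∎

translate : ∀ {n} → Config n → ℤ → Config n
translate C c u = C u + c

module _ {n} (G : Graph n) where

  sameFlow-translate : ∀ C c → SameFlow G C (translate C c)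
  sameFlow-translate C c u v _ = sym (flow-+ʳ (C u) (C v) c)

  step-translate : ∀ C c → step G (translate C c) ≋ translate (step G C) c
  step-translate C c v =
    trans (cong (_+_ (C v + c)) (sym (inflow-cong G C (translate C c) (sameFlow-translate C c) v)))
          (swap (C v) c (inflow G C v))
    where
    swap : ∀ x c i → x + c + i ≡ x + i + c
    swap = solve-∀

  period2-translate : ∀ {C} c → Period2 G C → Period2 G (translate C c)
  period2-translate {C} c = period2-transfer G (sameFlow-translate C c) λ u v uv →
    trans (sameFlow-translate (step G C) c u v uv)
          (sym (cong₂ flow (step-translate C c u) (step-translate C c v)))

sum-tabulate-zero : ∀ {k} (φ : Fin k → ℤ) → (∀ u → φ u ≡ 0ℤ) → sumℤ (tabulate φ) ≡ 0ℤ
sum-tabulate-zero {zero}  φ vanish = refl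
sum-tabulate-zero {suc k} φ vanish = cong₂ _+_ (vanish zero) (sum-tabulate-zero (φ ∘ suc) (vanish ∘ suc))

sum-tabulate-single : ∀ {k} (φ : Fin k → ℤ) i → (∀ u → u ≢ i → φ u ≡ 0ℤ) →
                      sumℤ (tabulate φ) ≡ φ i
sum-tabulate-single φ zero vanish =
  trans (cong (_+_ (φ zero)) (sum-tabulate-zero (φ ∘ suc) λ u → vanish (suc u) λ ()))
        (+-identityʳ (φ zero))
sum-tabulate-single φ (suc i) vanish =
  trans (cong₂ _+_ (vanish zero λ ())
                   (sum-tabulate-single (φ ∘ suc) i λ u u≢i → vanish (suc u) (u≢i ∘ suc-injective)))
        (+-identityˡ (φ (suc i)))

sum-tabulate-pair : ∀ {k} (φ : Fin k → ℤ) i j → i ≢ j →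
                    (∀ u → u ≢ i → u ≢ j → φ u ≡ 0ℤ) →
                    sumℤ (tabulate φ) ≡ φ i + φ j
sum-tabulate-pair φ zero zero i≢j vanish = ⊥-elim (i≢j refl)
sum-tabulate-pair φ zero (suc j) i≢j vanish =
  cong (_+_ (φ zero))
       (sum-tabulate-single (φ ∘ suc) j λ u u≢j → vanish (suc u) (λ ()) (u≢j ∘ suc-injective))
sum-tabulate-pair φ (suc i) zero i≢j vanish =
  trans (cong (_+_ (φ zero))
              (sum-tabulate-single (φ ∘ suc) i λ u u≢i → vanish (suc u) (u≢i ∘ suc-injective) (λ ())))
        (+-comm (φ zero) (φ (suc i)))
sum-tabulate-pair φ (suc i) (suc j) i≢j vanish =
  trans (cong₂ _+_ (vanish zero (λ ()) (λ ()))
                   (sum-tabulate-pair (φ ∘ suc) i j (i≢j ∘ cong suc) λ u u≢i u≢j →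
                      vanish (suc u) (u≢i ∘ suc-injective) (u≢j ∘ suc-injective)))
        (+-identityˡ (φ (suc i) + φ (suc j)))

if-nonTrue : ∀ {b} {x : ℤ} → b ≢ true → (if b then x else 0ℤ) ≡ 0ℤ
if-nonTrue {true}  b≢true = ⊥-elim (b≢true refl)
if-nonTrue {false} _      = refl

if-true : ∀ {b} {x y : ℤ} → b ≡ true → (if b then x else y) ≡ x
if-true refl = refl

module _ {n} (G : Graph n) (C : Config n) {v : Fin n} where

  private
    term : Fin n → ℤ
    term u = if G u v then flow (C u) (C v) else 0ℤ

    inflow≡sum : inflow G C v ≡ sumℤ (tabulate term)
    inflow≡sum = cong sumℤ (map-tabulate id term)

  inflow-single : ∀ {i} → G i v ≡ true → (∀ u → G u v ≡ true → u ≡ i) →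
                  inflow G C v ≡ flow (C i) (C v)
  inflow-single {i} iv only =
    trans inflow≡sum (trans (sum-tabulate-single term i λ u u≢i → if-nonTrue (u≢i ∘ only u)) (if-true iv))

  inflow-pair : ∀ {i j} → i ≢ j → G i v ≡ true → G j v ≡ true →
                (∀ u → G u v ≡ true → u ≡ i ⊎ u ≡ j) →
                inflow G C v ≡ flow (C i) (C v) + flow (C j) (C v)
  inflow-pair {i} {j} i≢j iv jv only =
    trans inflow≡sum (trans (sum-tabulate-pair term i j i≢j vanish) (cong₂ _+_ (if-true iv) (if-true jv)))
    where
    vanish : ∀ u → u ≢ i → u ≢ j → term u ≡ 0ℤ
    vanish u u≢i u≢j = if-nonTrue λ uv → Sum.[ u≢i , u≢j ] (only u uv)

-- A leaf hanging from a vertex of degree two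

IsUnit : ℤ → Set
IsUnit t = t ≡ 1ℤ ⊎ t ≡ - 1ℤ

IsUnit-neg : ∀ {t} → IsUnit t → IsUnit (- t)
IsUnit-neg (inj₁ refl) = inj₂ refl
IsUnit-neg (inj₂ refl) = inj₁ refl

unit≢double : ∀ {t} → IsUnit t → t ≢ t + t
unit≢double (inj₁ refl) ()
unit≢double (inj₂ refl) ()

dirFlow-unit : ∀ {d} → d ≢ flat → IsUnit (dirFlow d)
dirFlow-unit {forward}  _ = inj₁ refl
dirFlow-unit {backward} _ = inj₂ refl
dirFlow-unit {flat} d≢flat = ⊥-elim (d≢flat refl)

-- With |p| = 0 and |ℓ| = d, and t the flow from q into p, leafFlow d t is the flow from p to ℓ
-- after one step; LeafCondition says that it reverses the flow before the step, which is exactly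
-- what makes |ℓ| return after two steps.
leafFlow : ℤ → ℤ → ℤ
leafFlow d t = flow (t + flow d 0ℤ) (d + flow 0ℤ d)

LeafCondition : ℤ → ℤ → Set
LeafCondition d t = leafFlow d t ≡ - flow 0ℤ d

leafCondition-flat : ∀ d → LeafCondition d 0ℤ → d ≡ flow d 0ℤ
leafCondition-flat (+ 0)                 _  = refl
leafCondition-flat (+ 1)                 _  = refl
leafCondition-flat (+ 2)                 ()
leafCondition-flat (+ suc (suc (suc k))) ()
leafCondition-flat -[1+ 0 ]              _  = refl
leafCondition-flat -[1+ 1 ]              ()
leafCondition-flat -[1+ suc (suc k) ]    ()

leafCondition-unit : ∀ {t} d → IsUnit t → LeafCondition d t → d ≡ t ⊎ d ≡ t + t
leafCondition-unit (+ 0)                     (inj₁ refl) ()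
leafCondition-unit (+ 1)                     (inj₁ refl) _  = inj₁ refl
leafCondition-unit (+ 2)                     (inj₁ refl) _  = inj₂ refl
leafCondition-unit (+ 3)                     (inj₁ refl) ()
leafCondition-unit (+ suc (suc (suc (suc k)))) (inj₁ refl) ()
leafCondition-unit -[1+ 0 ]                  (inj₁ refl) ()
leafCondition-unit -[1+ 1 ]                  (inj₁ refl) ()
leafCondition-unit -[1+ suc (suc k) ]        (inj₁ refl) ()
leafCondition-unit (+ 0)                     (inj₂ refl) ()
leafCondition-unit (+ 1)                     (inj₂ refl) ()
leafCondition-unit (+ 2)                     (inj₂ refl) ()
leafCondition-unit (+ suc (suc (suc k)))     (inj₂ refl) ()
leafCondition-unit -[1+ 0 ]                  (inj₂ refl) _  = inj₁ refl
leafCondition-unit -[1+ 1 ]                  (inj₂ refl) _  = inj₂ refl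
leafCondition-unit -[1+ 2 ]                  (inj₂ refl) ()
leafCondition-unit -[1+ suc (suc (suc k)) ]  (inj₂ refl) ()

unit-leafCondition : ∀ {t d} → IsUnit t → d ≡ t ⊎ d ≡ t + t → LeafCondition d t
unit-leafCondition (inj₁ refl) (inj₁ refl) = refl
unit-leafCondition (inj₁ refl) (inj₂ refl) = refl
unit-leafCondition (inj₂ refl) (inj₁ refl) = refl
unit-leafCondition (inj₂ refl) (inj₂ refl) = refl

unit-offset-flow : ∀ {t d} → IsUnit t → d ≡ t ⊎ d ≡ t + t → flow 0ℤ d ≡ - t
unit-offset-flow (inj₁ refl) (inj₁ refl) = refl
unit-offset-flow (inj₁ refl) (inj₂ refl) = refl
unit-offset-flow (inj₂ refl) (inj₁ refl) = refl
unit-offset-flow (inj₂ refl) (inj₂ refl) = refl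

record PendantPath {n} (G : Graph n) (q p ℓ : Fin n) : Set where
  field
    symmetric : ∀ u v → G u v ≡ G v u
    p∼ℓ       : G p ℓ ≡ true
    q∼p       : G q p ≡ true
    q≢ℓ       : q ≢ ℓ
    ℓ-nbr     : ∀ u → G u ℓ ≡ true → u ≡ p
    p-nbr     : ∀ u → G u p ≡ true → u ≡ q ⊎ u ≡ ℓ

module PendantPathProperties {n} {G : Graph n} {q p ℓ : Fin n} (pp : PendantPath G q p ℓ) where
  open PendantPath pp
  open ≡-Reasoning

  p≢ℓ : p ≢ ℓ
  p≢ℓ refl = q≢ℓ (ℓ-nbr q q∼p)

  offset : Config n → ℤ
  offset C = C ℓ - C p

  stemFlow : Config n → ℤ
  stemFlow C = flow (C q) (C p)

  step-leafFlow : ∀ D → flow (step G D p) (step G D ℓ) ≡ leafFlow (offset D) (stemFlow D)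
  step-leafFlow D = begin
    flow (D p + inflow G D p) (D ℓ + inflow G D ℓ)
      ≡⟨ cong₂ (λ x y → flow (D p + x) (D ℓ + y))
               (inflow-pair G D q≢ℓ q∼p (trans (symmetric ℓ p) p∼ℓ) p-nbr)
               (inflow-single G D p∼ℓ ℓ-nbr) ⟩
    flow (D p + (stemFlow D + flow (D ℓ) (D p))) (D ℓ + flow (D p) (D ℓ))
      ≡⟨ cong₂ (λ x y → flow (D p + (stemFlow D + x)) (D ℓ + y))
               (flow-offsetˡ (D p) (D ℓ)) (flow-offsetʳ (D p) (D ℓ)) ⟩
    flow (D p + (stemFlow D + flow (offset D) 0ℤ)) (D ℓ + flow 0ℤ (offset D))
      ≡⟨ cong₂ flow (+-comm (D p) _) (recentre (D ℓ) (D p) _) ⟩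
    flow (stemFlow D + flow (offset D) 0ℤ + D p) (offset D + flow 0ℤ (offset D) + D p)
      ≡⟨ flow-+ʳ (stemFlow D + flow (offset D) 0ℤ) (offset D + flow 0ℤ (offset D)) (D p) ⟩
    leafFlow (offset D) (stemFlow D) ∎
    where
    recentre : ∀ b a y → b + y ≡ b - a + y + a
    recentre = solve-∀

  period2⇒leafCondition : ∀ {D} → step G (step G D) ≋ D → LeafCondition (offset D) (stemFlow D)
  period2⇒leafCondition {D} e = begin
    leafFlow (offset D) (stemFlow D) ≡⟨ step-leafFlow D ⟨
    flow (step G D p) (step G D ℓ)   ≡⟨ inflow-single G (step G D) p∼ℓ ℓ-nbr ⟨
    inflow G (step G D) ℓ            ≡⟨ period2-inflow G e ℓ ⟩
    - inflow G D ℓ                   ≡⟨ cong -_ (inflow-single G D p∼ℓ ℓ-nbr) ⟩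
    - flow (D p) (D ℓ)               ≡⟨ cong -_ (flow-offsetʳ (D p) (D ℓ)) ⟩
    - flow 0ℤ (offset D)             ∎

  offset-flat : ∀ {D} → step G (step G D) ≋ D → stemFlow D ≡ 0ℤ → offset D ≡ flow (D ℓ) (D p)
  offset-flat {D} e noStem =
    trans (leafCondition-flat _ (subst (LeafCondition (offset D)) noStem (period2⇒leafCondition e)))
          (sym (flow-offsetˡ (D p) (D ℓ)))

  offset-unit : ∀ {D} → step G (step G D) ≋ D → IsUnit (stemFlow D) →
                offset D ≡ stemFlow D ⊎ offset D ≡ stemFlow D + stemFlow D
  offset-unit e unit = leafCondition-unit _ unit (period2⇒leafCondition e)

  setOffset : Config n → ℤ → Config n
  setOffset C d = updateAt C ℓ (λ _ → C p + d)

  setOffset-leaf : ∀ C d → setOffset C d ℓ ≡ C p + d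
  setOffset-leaf C d = updateAt-updates ℓ C

  setOffset-agrees : ∀ C d u → u ≢ ℓ → C u ≡ setOffset C d u
  setOffset-agrees C d u u≢ℓ = sym (updateAt-minimal u ℓ C u≢ℓ)

  offset-setOffset : ∀ C d → offset (setOffset C d) ≡ d
  offset-setOffset C d = begin
    setOffset C d ℓ - setOffset C d p ≡⟨ cong₂ _-_ (setOffset-leaf C d) (sym (setOffset-agrees C d p p≢ℓ)) ⟩
    C p + d - C p                     ≡⟨ x+y-x≡y (C p) d ⟩
    d                                 ∎

  sameFlow-offLeaf : ∀ {C C'} → (∀ u → u ≢ ℓ → C u ≡ C' u) →
                     flow (C p) (C ℓ) ≡ flow (C' p) (C' ℓ) →
                     SameFlow G C C'
  sameFlow-offLeaf {C} {C'} agree pℓ u v uv with u ≟ ℓ | v ≟ ℓ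
  ... | yes refl | yes refl = ⊥-elim (p≢ℓ (sym (ℓ-nbr ℓ uv)))
  ... | yes refl | no _ with ℓ-nbr v (trans (symmetric v ℓ) uv)
  ...   | refl = trans (flow-anti (C p) (C ℓ)) (trans (cong -_ pℓ) (sym (flow-anti (C' p) (C' ℓ))))
  sameFlow-offLeaf agree pℓ u v uv | no _ | yes refl with ℓ-nbr u uv
  ...   | refl = pℓ
  sameFlow-offLeaf agree pℓ u v uv | no u≢ℓ | no v≢ℓ = cong₂ flow (agree u u≢ℓ) (agree v v≢ℓ)

  period2-setOffset : ∀ {C d} → Period2 G C → IsUnit (stemFlow C) →
                      d ≡ stemFlow C ⊎ d ≡ stemFlow C + stemFlow C →
             Period2 G (setOffset C d) × SameFlow G C (setOffset C d)
  period2-setOffset {C} {d} period@(e , _) unit d-allowed = period2-transfer G sf sf' period , sf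
    where
    C' = setOffset C d
    agree = setOffset-agrees C d
    t = stemFlow C
    d'-allowed : offset C' ≡ t ⊎ offset C' ≡ t + t
    d'-allowed = subst (λ x → x ≡ t ⊎ x ≡ t + t) (sym (offset-setOffset C d)) d-allowed
    sameSign : flow 0ℤ (offset C) ≡ flow 0ℤ (offset C')
    sameSign = trans (unit-offset-flow unit (offset-unit e unit)) (sym (unit-offset-flow unit d'-allowed))
    sf : SameFlow G C C'
    sf = sameFlow-offLeaf agree
           (trans (flow-offsetʳ (C p) (C ℓ)) (trans sameSign (sym (flow-offsetʳ (C' p) (C' ℓ)))))
    sf' : SameFlow G (step G C) (step G C')
    sf' = sameFlow-offLeaf (step-agree G sf agree) (begin
      flow (step G C p) (step G C ℓ)     ≡⟨ step-leafFlow C ⟩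
      leafFlow (offset C) t              ≡⟨ period2⇒leafCondition e ⟩
      - flow 0ℤ (offset C)               ≡⟨ cong -_ sameSign ⟩
      - flow 0ℤ (offset C')              ≡⟨ unit-leafCondition unit d'-allowed ⟨
      leafFlow (offset C') t             ≡⟨ cong₂ (λ x y → leafFlow (offset C') (flow x y)) (agree q q≢ℓ) (agree p p≢ℓ) ⟩
      leafFlow (offset C') (stemFlow C') ≡⟨ step-leafFlow C' ⟨
      flow (step G C' p) (step G C' ℓ)   ∎)

-- The path P_n

pathGraph-sym : ∀ N u v → pathGraph N u v ≡ pathGraph N v u
pathGraph-sym N u v = ∨-comm (suc (toℕ u) ℕ.≡ᵇ toℕ v) (suc (toℕ v) ℕ.≡ᵇ toℕ u)

pathGraph-edge : ∀ {n} (i : Fin n) → pathGraph (suc n) (inject₁ i) (suc i) ≡ true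
pathGraph-edge zero    = refl
pathGraph-edge (suc i) = pathGraph-edge i

frontPendant : ∀ m → PendantPath (pathGraph (suc (suc (suc m)))) (suc (suc zero)) (suc zero) zero
frontPendant m = record
  { symmetric = pathGraph-sym _
  ; p∼ℓ = refl
  ; q∼p = refl
  ; q≢ℓ = λ ()
  ; ℓ-nbr = ℓ-nbr
  ; p-nbr = p-nbr
  }
  where
  ℓ-nbr : ∀ u → pathGraph _ u zero ≡ true → u ≡ suc zero
  ℓ-nbr zero          ()
  ℓ-nbr (suc zero)    _ = refl
  ℓ-nbr (suc (suc u)) ()
  p-nbr : ∀ u → pathGraph _ u (suc zero) ≡ true → u ≡ suc (suc zero) ⊎ u ≡ zero
  p-nbr zero                _ = inj₂ refl
  p-nbr (suc zero)          ()
  p-nbr (suc (suc zero))    _ = inj₁ refl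
  p-nbr (suc (suc (suc u))) ()

pendant-suc : ∀ {N} {q : Fin (suc N)} {p ℓ : Fin N} →
              PendantPath (pathGraph (suc N)) q (suc p) (suc ℓ) →
              PendantPath (pathGraph (suc (suc N))) (suc q) (suc (suc p)) (suc (suc ℓ))
pendant-suc pp = record
  { symmetric = pathGraph-sym _
  ; p∼ℓ = p∼ℓ
  ; q∼p = q∼p
  ; q≢ℓ = q≢ℓ ∘ suc-injective
  ; ℓ-nbr = λ { zero (); (suc u) uℓ → cong suc (ℓ-nbr u uℓ) }
  ; p-nbr = λ { zero (); (suc u) up → Sum.map (cong suc) (cong suc) (p-nbr u up) }
  }
  where open PendantPath pp

endPendant : ∀ m → PendantPath (pathGraph (suc (suc (suc m))))
                     (inject₁ (inject₁ (fromℕ m))) (inject₁ (fromℕ (suc m))) (fromℕ (suc (suc m)))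
endPendant zero = record
  { symmetric = pathGraph-sym _
  ; p∼ℓ = refl
  ; q∼p = refl
  ; q≢ℓ = λ ()
  ; ℓ-nbr = ℓ-nbr
  ; p-nbr = p-nbr
  }
  where
  ℓ-nbr : ∀ u → pathGraph 3 u (suc (suc zero)) ≡ true → u ≡ suc zero
  ℓ-nbr zero             ()
  ℓ-nbr (suc zero)       _ = refl
  ℓ-nbr (suc (suc zero)) ()
  p-nbr : ∀ u → pathGraph 3 u (suc zero) ≡ true → u ≡ zero ⊎ u ≡ suc (suc zero)
  p-nbr zero             _ = inj₁ refl
  p-nbr (suc zero)       ()
  p-nbr (suc (suc zero)) _ = inj₂ refl
endPendant (suc m) = pendant-suc (endPendant m)

orient-cong : ∀ {n} {C C' : Config (suc n)} → SameFlow (pathGraph (suc n)) C C' → orient C ≡ orient C'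
orient-cong {C = C} {C'} sf = tabulate-cong λ i →
  dirFlow-injective (begin
    dirFlow (cmpDir (C (inject₁ i)) (C (suc i)))   ≡⟨ flow≡dirFlow (C (inject₁ i)) (C (suc i)) ⟨
    flow (C (inject₁ i)) (C (suc i))               ≡⟨ sf (inject₁ i) (suc i) (pathGraph-edge i) ⟩
    flow (C' (inject₁ i)) (C' (suc i))             ≡⟨ flow≡dirFlow (C' (inject₁ i)) (C' (suc i)) ⟩
    dirFlow (cmpDir (C' (inject₁ i)) (C' (suc i))) ∎)
  where open ≡-Reasoning

orient-flow : ∀ {n} (D : Config (suc n)) {R} → orient D ≡ R → ∀ i →
              flow (D (inject₁ i)) (D (suc i)) ≡ dirFlow (lookup R i)
orient-flow D refl i =
  trans (flow≡dirFlow (D (inject₁ i)) (D (suc i)))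
        (cong dirFlow (sym (lookup∘tabulate (λ j → cmpDir (D (inject₁ j)) (D (suc j))) i)))

-- Counting the values of a vertex

hasExactly-one : ∀ {P : ℤ → Set} {x} → P x → (∀ b → P b → b ≡ x) → HasExactly 1 P
hasExactly-one {x = x} px only =
  x ∷ [] , refl , [] ∷ [] , λ b → mk⇔ (λ pb → here (only b pb)) λ { (here refl) → px }

hasExactly-two : ∀ {P : ℤ → Set} {x y} → x ≢ y → P x → P y →
                 (∀ b → P b → b ≡ x ⊎ b ≡ y) → HasExactly 2 P
hasExactly-two {P = P} {x} {y} x≢y px py only =
  x ∷ y ∷ [] , refl , (x≢y ∷ []) ∷ [] ∷ [] , λ b → mk⇔ (to b) from
  where
  to : ∀ b → P b → b ∈ x ∷ y ∷ []
  to b pb with only b pb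
  ... | inj₁ refl = here refl
  ... | inj₂ refl = there (here refl)
  from : ∀ {b} → b ∈ x ∷ y ∷ [] → P b
  from (here refl)         = px
  from (there (here refl)) = py

Realises : ∀ {n} → Vec Dir n → Config (suc n) → Set
Realises {n} R C = Period2 (pathGraph (suc n)) C × C zero ≡ 0ℤ × orient C ≡ R

module _ {n} {R : Vec Dir n} {v : Fin (suc n)} {a : Fin (suc n) → ℤ} where

  realises : ∀ {C} → IsP2Path C → orient C ≡ R → Realises R C
  realises (p2 , zero≡0) o = IsP2Config⇒Period2 _ p2 , zero≡0 , o

  candidate : ∀ {C b} → Realises R C → AgreesBefore v C a → C v ≡ b → Candidate R v a b
  candidate (period , zero≡0 , o) agree Cv≡b =
    _ , (Period2⇒IsP2Config _ period , zero≡0) , o , agree , Cv≡b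

  multiplier-one : ∀ {x} → (∀ {C} → Realises R C → AgreesBefore v C a → C v ≡ x) →
                   Admissible R v a → MultiplierIs R v a 1
  multiplier-one only (C , path , o , agree) =
    hasExactly-one (candidate r agree (only r agree)) λ where
      b (D , path' , o' , agree' , Dv≡b) → trans (sym Dv≡b) (only (realises path' o') agree')
    where r = realises path o

  multiplier-two : ∀ {x y} → x ≢ y →
                   (∀ {C} → Realises R C → AgreesBefore v C a → C v ≡ x ⊎ C v ≡ y) →
                   (∀ {C} → Realises R C → AgreesBefore v C a →
                      ∀ {b} → b ≡ x ⊎ b ≡ y → Candidate R v a b) →
                   Admissible R v a → MultiplierIs R v a 2
  multiplier-two x≢y confined reach (C , path , o , agree) =
    hasExactly-two x≢y (reach r agree (inj₁ refl)) (reach r agree (inj₂ refl)) λ where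
      b (D , path' , o' , agree' , Dv≡b) →
        Sum.map (trans (sym Dv≡b)) (trans (sym Dv≡b)) (confined (realises path' o') agree')
    where r = realises path o

module Front (m : ℕ) {R : Vec Dir (suc (suc m))} {a : Fin (suc (suc (suc m))) → ℤ} where
  open PendantPathProperties (frontPendant m)

  s : ℤ
  s = dirFlow (lookup R (suc zero))

  stemFlow≡-s : ∀ {C} → Realises R C → stemFlow C ≡ - s
  stemFlow≡-s {C} (_ , _ , o) =
    trans (flow-anti (C (suc zero)) (C (suc (suc zero)))) (cong -_ (orient-flow C o (suc zero)))

  stemFlow-unit : lookup R (suc zero) ≢ flat → ∀ {C} → Realises R C → IsUnit (stemFlow C)
  stemFlow-unit nf r = subst IsUnit (sym (stemFlow≡-s r)) (IsUnit-neg (dirFlow-unit nf))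

  offset≡0-v₂ : ∀ {C} → Realises R C → offset C ≡ 0ℤ - C (suc zero)
  offset≡0-v₂ {C} (_ , zero≡0 , _) = cong (_- C (suc zero)) zero≡0

  front-flat : lookup R (suc zero) ≡ flat → ∀ {C} → Realises R C → AgreesBefore (suc zero) C a →
               C (suc zero) ≡ - dirFlow (lookup R zero)
  front-flat e₂-flat {C} r@((e , _) , _ , o) _ = 0-x≡y⇒x≡-y _ _ (begin
    0ℤ - C (suc zero)            ≡⟨ offset≡0-v₂ r ⟨
    offset C                     ≡⟨ offset-flat {C} e (trans (stemFlow≡-s r) (cong (-_ ∘ dirFlow) e₂-flat)) ⟩
    flow (C zero) (C (suc zero)) ≡⟨ orient-flow C o zero ⟩
    dirFlow (lookup R zero)      ∎)
    where open ≡-Reasoning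

  front-confined : lookup R (suc zero) ≢ flat → ∀ {C} → Realises R C → AgreesBefore (suc zero) C a →
                   C (suc zero) ≡ s ⊎ C (suc zero) ≡ s + s
  front-confined nf {C} r@((e , _) , _ , _) _ =
    Sum.map single double (offset-unit {C} e (stemFlow-unit nf r))
    where
    t≡-s = stemFlow≡-s r
    single : offset C ≡ stemFlow C → C (suc zero) ≡ s
    single h = trans (0-x≡y⇒x≡-y _ _ (trans (sym (offset≡0-v₂ r)) (trans h t≡-s))) (neg-involutive s)
    double : offset C ≡ stemFlow C + stemFlow C → C (suc zero) ≡ s + s
    double h = trans (0-x≡y⇒x≡-y _ _ (trans (sym (offset≡0-v₂ r)) (trans h (cong₂ _+_ t≡-s t≡-s))))
                     (neg-double s)
      where
      neg-double : ∀ s → - (- s + - s) ≡ s + s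
      neg-double = solve-∀

  front-reach : lookup R (suc zero) ≢ flat → ∀ {C} → Realises R C → AgreesBefore (suc zero) C a →
                ∀ {b} → b ≡ s ⊎ b ≡ s + s → Candidate R (suc zero) a b
  -- Put v₁ at offset -b from v₂, then translate so that |v₁| = 0 again.
  front-reach nf {C} r@(period , zero≡0 , o) agree {b} b-allowed =
    candidate (period2-translate (pathGraph _) c (proj₁ moved) , +-inverseʳ (C₁ zero) , orient₂) agree₂ value
    where
    t≡-s = stemFlow≡-s r
    d-allowed : - b ≡ stemFlow C ⊎ - b ≡ stemFlow C + stemFlow C
    d-allowed = Sum.map (λ { refl → sym t≡-s })
                        (λ { refl → trans (neg-distrib-+ s s) (sym (cong₂ _+_ t≡-s t≡-s)) })
                        b-allowed
    moved = period2-setOffset period (stemFlow-unit nf r) d-allowed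
    C₁ = setOffset C (- b)
    c = - C₁ zero
    orient₂ : orient (translate C₁ c) ≡ R
    orient₂ = trans (sym (orient-cong {C = C₁} {translate C₁ c} (sameFlow-translate _ C₁ c)))
                    (trans (sym (orient-cong {C = C} {C₁} (proj₂ moved))) o)
    agree₂ : AgreesBefore (suc zero) (translate C₁ c) a
    agree₂ zero    _         = trans (+-inverseʳ (C₁ zero)) (trans (sym zero≡0) (agree zero (s≤s z≤n)))
    agree₂ (suc i) (s≤s ())
    value : translate C₁ c (suc zero) ≡ b
    value = begin
      C₁ (suc zero) + - C₁ zero
        ≡⟨ cong₂ (λ x y → x + - y) (setOffset-agrees C (- b) (suc zero) (λ ())) (setOffset-leaf C (- b)) ⟨
      C (suc zero) + - (C (suc zero) + - b)
        ≡⟨ recover (C (suc zero)) b ⟩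
      b ∎
      where
      open ≡-Reasoning
      recover : ∀ x b → x + - (x + - b) ≡ b
      recover = solve-∀

module End (m : ℕ) {R : Vec Dir (suc (suc m))} {a : Fin (suc (suc (suc m))) → ℤ} where
  open PendantPathProperties (endPendant m)

  L P : Fin (suc (suc (suc m)))
  L = fromℕ (suc (suc m))
  P = inject₁ (fromℕ (suc m))

  s : ℤ
  s = dirFlow (lookup R (inject₁ (fromℕ m)))

  P<L : toℕ P ℕ.< toℕ L
  P<L = s≤s (≤-reflexive (toℕ-inject₁ (fromℕ (suc m))))

  stemFlow≡s : ∀ {C} → Realises R C → stemFlow C ≡ s
  stemFlow≡s {C} (_ , _ , o) = orient-flow C o (inject₁ (fromℕ m))

  stemFlow-unit : lookup R (inject₁ (fromℕ m)) ≢ flat → ∀ {C} → Realises R C → IsUnit (stemFlow C)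
  stemFlow-unit nf r = subst IsUnit (sym (stemFlow≡s r)) (dirFlow-unit nf)

  end-flat : lookup R (inject₁ (fromℕ m)) ≡ flat → ∀ {C} → Realises R C → AgreesBefore L C a →
             C L ≡ a P - dirFlow (lookup R (fromℕ (suc m)))
  end-flat eₙ₋₂-flat {C} r@((e , _) , _ , o) agree =
    trans (x-y≡z⇒x≡y+z _ _ _ (begin
      offset C           ≡⟨ offset-flat {C} e (trans (stemFlow≡s r) (cong dirFlow eₙ₋₂-flat)) ⟩
      flow (C L) (C P)   ≡⟨ flow-anti (C P) (C L) ⟩
      - flow (C P) (C L) ≡⟨ cong -_ (orient-flow C o (fromℕ (suc m))) ⟩
      - dirFlow (lookup R (fromℕ (suc m))) ∎))
      (cong (_- dirFlow (lookup R (fromℕ (suc m)))) (agree P P<L))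
    where open ≡-Reasoning

  end-confined : lookup R (inject₁ (fromℕ m)) ≢ flat → ∀ {C} → Realises R C → AgreesBefore L C a →
                 C L ≡ a P + s ⊎ C L ≡ a P + (s + s)
  end-confined nf {C} r@((e , _) , _ , _) agree =
    Sum.map (λ h → trans (x-y≡z⇒x≡y+z _ _ _ h) (cong₂ _+_ (agree P P<L) t≡s))
            (λ h → trans (x-y≡z⇒x≡y+z _ _ _ h) (cong₂ _+_ (agree P P<L) (cong₂ _+_ t≡s t≡s)))
            (offset-unit {C} e (stemFlow-unit nf r))
    where t≡s = stemFlow≡s r

  end-reach : lookup R (inject₁ (fromℕ m)) ≢ flat → ∀ {C} → Realises R C → AgreesBefore L C a →
              ∀ {b} → b ≡ a P + s ⊎ b ≡ a P + (s + s) → Candidate R L a b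
  end-reach nf {C} r@(period , zero≡0 , o) agree {b} b-allowed =
    candidate (proj₁ moved , trans (sym (setOffset-agrees C d zero λ ())) zero≡0 , orient₁) agree₁ value
    where
    t≡s = stemFlow≡s r
    d = b - C P
    CP≡aP = agree P P<L
    d-allowed : d ≡ stemFlow C ⊎ d ≡ stemFlow C + stemFlow C
    d-allowed = Sum.map
      (λ { refl → trans (cong (λ x → a P + s - x) CP≡aP) (trans (x+y-x≡y (a P) s) (sym t≡s)) })
      (λ { refl → trans (cong (λ x → a P + (s + s) - x) CP≡aP)
                        (trans (x+y-x≡y (a P) (s + s)) (sym (cong₂ _+_ t≡s t≡s))) })
      b-allowed
    moved = period2-setOffset period (stemFlow-unit nf r) d-allowed
    C₁ = setOffset C d
    orient₁ : orient C₁ ≡ R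
    orient₁ = trans (sym (orient-cong {C = C} {C₁} (proj₂ moved))) o
    agree₁ : AgreesBefore L C₁ a
    agree₁ i i<L = trans (sym (setOffset-agrees C d i λ { refl → <-irrefl refl i<L })) (agree i i<L)
    value : C₁ L ≡ b
    value = trans (setOffset-leaf C d) (x+[y-x]≡y (C P) b)

theorem4 : (m : ℕ) (R : Vec Dir (suc (suc m))) → IsP2Orientation R →
    (∀ (a : Fin (suc (suc (suc m))) → ℤ) → Admissible R zero a → MultiplierIs R zero a 1)
  × ((∀ (a : Fin (suc (suc (suc m))) → ℤ) → Admissible R (suc zero) a →
        lookup R (suc zero) ≡ flat → MultiplierIs R (suc zero) a 1)
    × (∀ (a : Fin (suc (suc (suc m))) → ℤ) → Admissible R (suc zero) a →
        lookup R (suc zero) ≢ flat → MultiplierIs R (suc zero) a 2))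
  × ((∀ (a : Fin (suc (suc (suc m))) → ℤ) → Admissible R (fromℕ (suc (suc m))) a →
        lookup R (inject₁ (fromℕ m)) ≡ flat → MultiplierIs R (fromℕ (suc (suc m))) a 1)
    × (∀ (a : Fin (suc (suc (suc m))) → ℤ) → Admissible R (fromℕ (suc (suc m))) a →
        lookup R (inject₁ (fromℕ m)) ≢ flat → MultiplierIs R (fromℕ (suc (suc m))) a 2))
theorem4 m R _ =
  (λ a → multiplier-one λ (_ , zero≡0 , _) _ → zero≡0)
  , ((λ a admissible e₂-flat → multiplier-one (Front.front-flat m e₂-flat) admissible)
    , (λ a admissible nf → multiplier-two (unit≢double (dirFlow-unit nf))
                             (Front.front-confined m nf) (Front.front-reach m nf) admissible))
  , ((λ a admissible eₙ₋₂-flat → multiplier-one (End.end-flat m eₙ₋₂-flat) admissible)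
    , (λ a admissible nf → multiplier-two (λ e → unit≢double (dirFlow-unit nf) (+-cancelˡ (a _) _ _ e))
                             (End.end-confined m nf) (End.end-reach m nf) admissible))
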